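{- Let $\chi$ be a binary position of birthday at most $2$. Then the misère monoid $\mathcal{M}_{\mathrm{cl}(\chi,\overline{\chi})}$ is infinite if and only if at least one of the positions $1$, $\overline{1}$, $\rho$, $\overline{\rho}$ lies in $\mathrm{cl}(\chi,\overline{\chi})$.
   Context: A position $\xi=\{\xi^L \mid \xi^R\}$ is given recursively by finite sets of Left and Right options; $\cdot$ denotes an empty set. $0=\{\cdot\mid\cdot\}$ (birthday $0$); the birthday of a position is $1$ plus the maximum birthday of its options. $*=\{0\mid0\}$, $1=\{0\mid\cdot\}$, $\overline{1}=\{\cdot\mid0\}$, $\rho=\{*\mid0\}$, $\overline{\rho}=\{0\mid *\}$. A position is binary if from every position in its game tree each player has at most one option. The conjugate is $\overline{\xi}=\{\overline{\xi^R}\mid\overline{\xi^L}\}$. Disjunctive sum: $\alpha+\beta=\{\alpha^L+\beta,\alpha+\beta^L \mid \alpha^R+\beta,\alpha+\beta^R\}$. Under misère play a player unable to move on their turn wins; $o^-$ denotes misère outcome ($\mathcal{L}$, $\mathcal{R}$, $\mathcal{N}$ next player wins, $\mathcal{P}$ next player loses). $\mathrm{cl}(\alpha,\beta)$ is the smallest set containing $\alpha,\beta$ closed under disjunctive sum and taking options. For closed $\Gamma$, $\alpha\equiv\beta\pmod\Gamma$ iff $o^-(\alpha+\gamma)=o^-(\beta+\gamma)$ for all $\gamma\in\Gamma$; the misère monoid $\mathcal{M}_\Gamma$ is the set of $\equiv$-classes with the monoid operation induced by disjunctive sum. -}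

module Defs where

open import Data.Nat using (ℕ; zero; suc; _⊔_)
open import Data.Bool using (Bool; true; false; not; _∨_)
open import Data.List using (List; []; _∷_; _++_; length)
open import Data.List.Relation.Unary.All using (All)
open import Data.List.Relation.Unary.Any using (Any)
open import Data.List.Membership.Propositional using (_∈_)
open import Data.Product using (Σ; _×_)
open import Relation.Binary.PropositionalEquality using (_≡_)
open import Relation.Nullary using (¬_)
open import Data.Nat using (_≤_)

-- A position (game form): finite lists of Left and Right options.
-- Lists represent finite sets; identity of positions is _≅_ below.
data Game : Set where
  ⟨_∣_⟩ : List Game → List Game → Game

leftOpts : Game → List Game
leftOpts ⟨ L ∣ _ ⟩ = L

rightOpts : Game → List Game
rightOpts ⟨ _ ∣ R ⟩ = R

data _≅_ : Game → Game → Set where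
  ≅-intro : ∀ {L R L' R'} →
            All (λ x → Any (x ≅_) L') L → All (λ y → Any (y ≅_) L) L' →
            All (λ x → Any (x ≅_) R') R → All (λ y → Any (y ≅_) R) R' →
            ⟨ L ∣ R ⟩ ≅ ⟨ L' ∣ R' ⟩

𝟎 : Game
𝟎 = ⟨ [] ∣ [] ⟩

⋆ : Game
⋆ = ⟨ 𝟎 ∷ [] ∣ 𝟎 ∷ [] ⟩

𝟏 : Game
𝟏 = ⟨ 𝟎 ∷ [] ∣ [] ⟩

𝟏bar : Game
𝟏bar = ⟨ [] ∣ 𝟎 ∷ [] ⟩

ρ : Game
ρ = ⟨ ⋆ ∷ [] ∣ 𝟎 ∷ [] ⟩

ρbar : Game
ρbar = ⟨ 𝟎 ∷ [] ∣ ⋆ ∷ [] ⟩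

mutual
  birthday : Game → ℕ
  birthday ⟨ [] ∣ [] ⟩ = 0
  birthday ⟨ L ∣ R ⟩ = suc (maxB L ⊔ maxB R)

  maxB : List Game → ℕ
  maxB [] = 0
  maxB (g ∷ gs) = birthday g ⊔ maxB gs

data Binary : Game → Set where
  binary : ∀ {L R} → length L ≤ 1 → length R ≤ 1 →
           All Binary L → All Binary R → Binary ⟨ L ∣ R ⟩

mutual
  conj : Game → Game
  conj ⟨ L ∣ R ⟩ = ⟨ conjs R ∣ conjs L ⟩

  conjs : List Game → List Game
  conjs [] = []
  conjs (g ∷ gs) = conj g ∷ conjs gs

mutual
  _⊕_ : Game → Game → Game
  g@(⟨ L ∣ R ⟩) ⊕ h@(⟨ L' ∣ R' ⟩) =
    ⟨ addL L h ++ addR g L' ∣ addL R h ++ addR g R' ⟩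

  addL : List Game → Game → List Game
  addL [] h = []
  addL (x ∷ xs) h = (x ⊕ h) ∷ addL xs h

  addR : Game → List Game → List Game
  addR g [] = []
  addR g (y ∷ ys) = (g ⊕ y) ∷ addR g ys

-- Misère play: a player unable to move wins.
mutual
  -- Left moving first wins
  leftFirst : Game → Bool
  leftFirst ⟨ [] ∣ _ ⟩ = true
  leftFirst ⟨ x ∷ xs ∣ _ ⟩ = someRightFirstLoses (x ∷ xs)

  -- Right moving first wins
  rightFirst : Game → Bool
  rightFirst ⟨ _ ∣ [] ⟩ = true
  rightFirst ⟨ _ ∣ y ∷ ys ⟩ = someLeftFirstLoses (y ∷ ys)

  someRightFirstLoses : List Game → Bool
  someRightFirstLoses [] = false
  someRightFirstLoses (g ∷ gs) = not (rightFirst g) ∨ someRightFirstLoses gs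

  someLeftFirstLoses : List Game → Bool
  someLeftFirstLoses [] = false
  someLeftFirstLoses (g ∷ gs) = not (leftFirst g) ∨ someLeftFirstLoses gs

data Outcome : Set where
  𝓛 𝓡 𝓝 𝓟 : Outcome

outcome⁻ : Game → Outcome
outcome⁻ g with leftFirst g | rightFirst g
... | true  | true  = 𝓝
... | true  | false = 𝓛
... | false | true  = 𝓡
... | false | false = 𝓟

data Cl (α β : Game) : Game → Set where
  cl-α   : Cl α β α
  cl-β   : Cl α β β
  cl-sum : ∀ {g h} → Cl α β g → Cl α β h → Cl α β (g ⊕ h)
  cl-L   : ∀ {g x} → Cl α β g → x ∈ leftOpts g → Cl α β x
  cl-R   : ∀ {g x} → Cl α β g → x ∈ rightOpts g → Cl α β x

_∈Γ_ : Game → (Game → Set) → Set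
x ∈Γ Γ = Σ Game (λ g → Γ g × (g ≅ x))

_≡[_]_ : Game → (Game → Set) → Game → Set
a ≡[ Γ ] b = ∀ γ → Γ γ → outcome⁻ (a ⊕ γ) ≡ outcome⁻ (b ⊕ γ)

-- The misère monoid M_Γ (classes of elements of Γ) is finite:
-- finitely many elements of Γ represent every class.
MonoidFinite : (Game → Set) → Set
MonoidFinite Γ = Σ (List Game) (λ xs → All Γ xs × (∀ g → Γ g → Any (λ x → g ≡[ Γ ] x) xs))

MonoidInfinite : (Game → Set) → Set
MonoidInfinite Γ = ¬ MonoidFinite Γ

module Submission where

open import Defs
open import Data.Nat using (ℕ; zero; suc; _+_; _≤_; _<_; s≤s; s≤s⁻¹; _≤?_; parity)
open import Data.Nat.Properties
  using (n<1+n; m⊔n≤o⇒m≤o; m⊔n≤o⇒n≤o; ≤-trans; m≤m⊔n; m≤n⊔m; +-suc; +-identityʳ;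
         <⇒≤; <⇒≱; ≰⇒>; ≤-refl)
open import Data.Parity.Base as ℙ using (Parity; 0ℙ; 1ℙ; _⁻¹)
open import Data.Parity.Properties using (suc-homo-⁻¹; ⁻¹-selfInverse; ⁻¹-involutive)
open import Data.Bool using (Bool; true; false; not; _∨_)
open import Data.Bool.Properties using (∨-zeroʳ)
open import Data.Bool.ListAction using (any)
open import Data.List using (List; []; _∷_; _++_; length; lookup)
open import Data.List.Relation.Unary.All as All using (All; []; _∷_; head)
open import Data.List.Relation.Unary.All.Properties using (++⁺)
open import Data.List.Relation.Unary.Any using (Any; here; there; index)
open import Data.List.Relation.Unary.Any.Properties using (lookup-index; ++⁺ˡ; ++⁺ʳ; ¬Any[])
open import Data.List.Membership.Propositional using (_∈_)
open import Data.Fin using (Fin; toℕ)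
open import Data.Fin.Properties using (pigeonhole)
open import Data.Product using (∃; _×_; _,_; proj₁; proj₂)
open import Data.Sum using (_⊎_; inj₁; inj₂)
open import Data.Empty using (⊥-elim)
open import Function using (_∘_)
open import Function.Bundles using (_⇔_; mk⇔)
open import Relation.Binary.PropositionalEquality
  using (_≡_; _≢_; refl; sym; trans; cong; cong₂; subst; subst₂; module ≡-Reasoning)
open import Relation.Nullary using (¬_; Dec; yes; no; does)
open import Relation.Nullary.Decidable using (dec-true; dec-false)

-- Such a χ has at most one option on each side, taken among 𝟎, 𝟏, 𝟏bar, ⋆ (simple), so the
-- proof is a case table (classify) with three kinds of cases.
--  • 𝟏 and 𝟏bar lie in the closure. The outcome of n·𝟏 + m·𝟏bar is computed for all n, m;
--    for n < m the position m·𝟏bar separates n·𝟏 from m·𝟏, and the pigeonhole principle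
--    (infinite-of-distinct) yields infinitely many classes.
--  • ρ and ρbar lie in the closure. The same argument with p·ρ + q·ρbar + k·⋆, whose outcome
--    depends only on p − q and the parity of k (table).
--  • χ is one of 𝟎, ⋆, {⋆|}, {|⋆}, {⋆|⋆}. Every position of the closure is then a parity game,
--    whose outcome depends on its parity alone, so there are at most two classes; and 𝟏, 𝟏bar,
--    ρ, ρbar are not parity games, so the closure avoids them.
-- Outcomes of arbitrary sums in the first two cases come from one general device: a Model
-- (abstract states with an addition, moves compatible with it, and a labelling satisfying the
-- misère recursion) whose states are realised additively by positions (ModelTheory).

outcomeOf : Bool → Bool → Outcome
outcomeOf true  true  = 𝓝
outcomeOf true  false = 𝓛
outcomeOf false true  = 𝓡
outcomeOf false false = 𝓟

outcome⁻-spec : ∀ g → outcome⁻ g ≡ outcomeOf (leftFirst g) (rightFirst g)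
outcome⁻-spec g with leftFirst g | rightFirst g
... | true  | true  = refl
... | true  | false = refl
... | false | true  = refl
... | false | false = refl

moverWins : (Game → Bool) → List Game → Bool
moverWins opponentWins []       = true
moverWins opponentWins (x ∷ xs) = any (not ∘ opponentWins) (x ∷ xs)

someRightFirstLoses-any : ∀ xs → someRightFirstLoses xs ≡ any (not ∘ rightFirst) xs
someRightFirstLoses-any []       = refl
someRightFirstLoses-any (x ∷ xs) = cong (not (rightFirst x) ∨_) (someRightFirstLoses-any xs)

someLeftFirstLoses-any : ∀ xs → someLeftFirstLoses xs ≡ any (not ∘ leftFirst) xs
someLeftFirstLoses-any []       = refl
someLeftFirstLoses-any (x ∷ xs) = cong (not (leftFirst x) ∨_) (someLeftFirstLoses-any xs)

leftFirst-unfold : ∀ L R → leftFirst ⟨ L ∣ R ⟩ ≡ moverWins rightFirst L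
leftFirst-unfold []       R = refl
leftFirst-unfold (x ∷ xs) R = someRightFirstLoses-any (x ∷ xs)

rightFirst-unfold : ∀ L R → rightFirst ⟨ L ∣ R ⟩ ≡ moverWins leftFirst R
rightFirst-unfold L []       = refl
rightFirst-unfold L (x ∷ xs) = someLeftFirstLoses-any (x ∷ xs)

mutual
  ≅-refl : ∀ g → g ≅ g
  ≅-refl ⟨ L ∣ R ⟩ = ≅-intro (each-in L) (each-in L) (each-in R) (each-in R)

  each-in : ∀ xs → All (λ x → Any (x ≅_) xs) xs
  each-in []       = []
  each-in (x ∷ xs) = here (≅-refl x) ∷ All.map there (each-in xs)

≅-sym : ∀ {g h} → g ≅ h → h ≅ g
≅-sym (≅-intro l l' r r') = ≅-intro l' l r' r

maxB-bound : ∀ {x xs} → x ∈ xs → birthday x ≤ maxB xs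
maxB-bound {xs = y ∷ ys} (here refl) = m≤m⊔n (birthday y) (maxB ys)
maxB-bound {xs = y ∷ ys} (there p)   = ≤-trans (maxB-bound p) (m≤n⊔m (birthday y) (maxB ys))

leftOption-younger : ∀ {x L R n} → x ∈ L → birthday ⟨ L ∣ R ⟩ ≤ suc n → birthday x ≤ n
leftOption-younger {L = L@(_ ∷ _)} {R} x∈L (s≤s b) =
  ≤-trans (maxB-bound x∈L) (m⊔n≤o⇒m≤o (maxB L) (maxB R) b)

rightOption-younger : ∀ {x L R n} → x ∈ R → birthday ⟨ L ∣ R ⟩ ≤ suc n → birthday x ≤ n
rightOption-younger {L = []}        {R = R@(_ ∷ _)} x∈R (s≤s b) =
  ≤-trans (maxB-bound x∈R) (m⊔n≤o⇒n≤o 0 (maxB R) b)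
rightOption-younger {L = L@(_ ∷ _)} {R = R@(_ ∷ _)} x∈R (s≤s b) =
  ≤-trans (maxB-bound x∈R) (m⊔n≤o⇒n≤o (maxB L) (maxB R) b)

data AtMostOne (P : Game → Set) : List Game → Set where
  none : AtMostOne P []
  one  : ∀ {x} → P x → AtMostOne P (x ∷ [])

YoungBinary : ℕ → Game → Set
YoungBinary n x = Binary x × birthday x ≤ n

binary-options : ∀ {L R n} → Binary ⟨ L ∣ R ⟩ → birthday ⟨ L ∣ R ⟩ ≤ suc n →
                 AtMostOne (YoungBinary n) L × AtMostOne (YoungBinary n) R
binary-options (binary |L|≤1 |R|≤1 bL bR) b = side |L|≤1 bL (λ x∈L → leftOption-younger x∈L b)
                                            , side |R|≤1 bR (λ x∈R → rightOption-younger x∈R b)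
  where
  side : ∀ {xs n} → length xs ≤ 1 → All Binary xs → (∀ {x} → x ∈ xs → birthday x ≤ n) →
         AtMostOne (YoungBinary n) xs
  side {[]}        _        _         _     = none
  side {_ ∷ []}    _        (bx ∷ []) young = one (bx , young (here refl))
  side {_ ∷ _ ∷ _} (s≤s ()) _         _

birthday≤0 : ∀ {x} → birthday x ≤ 0 → x ≡ 𝟎
birthday≤0 {⟨ [] ∣ [] ⟩} _ = refl

data Simple : Game → Set where
  s𝟎    : Simple 𝟎
  s𝟏    : Simple 𝟏
  s𝟏bar : Simple 𝟏bar
  s⋆    : Simple ⋆

only-𝟎 : ∀ {xs} → AtMostOne (YoungBinary 0) xs → AtMostOne (_≡ 𝟎) xs
only-𝟎 none           = none
only-𝟎 (one (_ , b0)) = one (birthday≤0 b0)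

simple : ∀ {x} → YoungBinary 1 x → Simple x
simple {⟨ L ∣ R ⟩} (bin , b) with binary-options bin b
... | l , r = shape (only-𝟎 l) (only-𝟎 r)
  where
  shape : ∀ {L R} → AtMostOne (_≡ 𝟎) L → AtMostOne (_≡ 𝟎) R → Simple ⟨ L ∣ R ⟩
  shape none       none       = s𝟎
  shape (one refl) none       = s𝟏
  shape none       (one refl) = s𝟏bar
  shape (one refl) (one refl) = s⋆

simple-options : ∀ {xs} → AtMostOne (YoungBinary 1) xs → AtMostOne Simple xs
simple-options none     = none
simple-options (one yb) = one (simple yb)

infinite-of-distinct : ∀ {Γ : Game → Set} (f : ℕ → Game) → (∀ n → Γ (f n)) →
                       (∀ {n m} → n < m → ¬ (f n ≡[ Γ ] f m)) → MonoidInfinite Γ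
infinite-of-distinct {Γ} f f∈Γ distinct (reps , _ , cover) =
  let (i , j , i<j , same) = pigeonhole (n<1+n (length reps)) classOf
  in distinct i<j λ γ γ∈Γ → begin
       outcome⁻ (f (toℕ i) ⊕ γ)                 ≡⟨ class i γ γ∈Γ ⟩
       outcome⁻ (lookup reps (classOf i) ⊕ γ)   ≡⟨ cong (λ k → outcome⁻ (lookup reps k ⊕ γ)) same ⟩
       outcome⁻ (lookup reps (classOf j) ⊕ γ)   ≡⟨ class j γ γ∈Γ ⟨
       outcome⁻ (f (toℕ j) ⊕ γ)                 ∎
  where
  open ≡-Reasoning
  classOf : Fin (suc (length reps)) → Fin (length reps)
  classOf i = index (cover (f (toℕ i)) (f∈Γ (toℕ i)))
  class : ∀ i → f (toℕ i) ≡[ Γ ] lookup reps (classOf i)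
  class i = lookup-index (cover (f (toℕ i)) (f∈Γ (toℕ i)))

infix 25 _·_
_·_ : ℕ → Game → Game
zero  · g = 𝟎
suc n · g = g ⊕ (n · g)

·-closed : ∀ {α β g} → Cl α β 𝟎 → Cl α β g → ∀ n → Cl α β (n · g)
·-closed 𝟎∈ g∈ zero    = 𝟎∈
·-closed 𝟎∈ g∈ (suc n) = cl-sum g∈ (·-closed 𝟎∈ g∈ n)

infinite-by-test : ∀ {Γ : Game → Set} g h → (∀ n → Γ (n · g)) → (∀ n → Γ (n · h)) →
                   (∀ {n m} → n < m → outcome⁻ (n · g ⊕ m · h) ≢ outcome⁻ (m · g ⊕ m · h)) →
                   MonoidInfinite Γ
infinite-by-test g h g∈Γ h∈Γ separated =
  infinite-of-distinct (_· g) g∈Γ (λ {_} {m} n<m equiv → separated n<m (equiv (m · h) (h∈Γ m)))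

record Compatible {S : Set} (_⊞_ : S → S → S) (_⇀_ : S → S → Set) : Set where
  field
    split   : ∀ {s t u} → (s ⊞ t) ⇀ u →
              (∃ λ s' → s ⇀ s' × u ≡ s' ⊞ t) ⊎ (∃ λ t' → t ⇀ t' × u ≡ s ⊞ t')
    inLeft  : ∀ {s s'} t → s ⇀ s' → (s ⊞ t) ⇀ (s' ⊞ t)
    inRight : ∀ s {t t'} → t ⇀ t' → (s ⊞ t) ⇀ (s ⊞ t')

-- wins s predicts whether the player moving along _⇀_ wins moving first from s, provided
-- opponentWins does so for the opponent: the misère recursion holds at every state.
record Labelling {S : Set} (_⇀_ : S → S → Set) (wins opponentWins : S → Bool) : Set where
  field
    winning : ∀ s → wins s ≡ true →
              (∀ u → ¬ s ⇀ u) ⊎ (∃ λ u → s ⇀ u × opponentWins u ≡ false)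
    losing  : ∀ s → wins s ≡ false →
              (∃ λ u → s ⇀ u) × (∀ u → s ⇀ u → opponentWins u ≡ true)

-- Positions realising abstract states: the Left (Right) options of a position realising s
-- realise exactly the targets of the Left (Right) moves from s.
module Realisation {S : Set} (_⊞_ : S → S → S) (_⇀ᴸ_ _⇀ᴿ_ : S → S → Set)
                   (compatibleᴸ : Compatible _⊞_ _⇀ᴸ_) (compatibleᴿ : Compatible _⊞_ _⇀ᴿ_) where

  record RealisesMoves (Rep : S → Game → Set) (_⇀_ : S → S → Set)
                       (s : S) (xs : List Game) : Set where
    constructor realisesMoves
    field
      sound    : All (λ x → ∃ λ s' → s ⇀ s' × Rep s' x) xs
      complete : ∀ {s'} → s ⇀ s' → Any (Rep s') xs

  data Realises : S → Game → Set where
    realises : ∀ {s L R} → RealisesMoves Realises _⇀ᴸ_ s L → RealisesMoves Realises _⇀ᴿ_ s R →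
               Realises s ⟨ L ∣ R ⟩

  no-moves : ∀ {_⇀_ s} → (∀ {u} → ¬ s ⇀ u) → RealisesMoves Realises _⇀_ s []
  no-moves stuck = realisesMoves [] (λ m → ⊥-elim (stuck m))

  one-move : ∀ {_⇀_ s u x} → s ⇀ u → Realises u x → (∀ {u'} → s ⇀ u' → u' ≡ u) →
             RealisesMoves Realises _⇀_ s (x ∷ [])
  one-move {x = x} m r unique =
    realisesMoves ((_ , m , r) ∷ []) (λ m' → here (subst (λ v → Realises v x) (sym (unique m')) r))

  mutual
    realises-⊕ : ∀ {s t} g h → Realises s g → Realises t h → Realises (s ⊞ t) (g ⊕ h)
    realises-⊕ ⟨ L ∣ R ⟩ ⟨ L' ∣ R' ⟩ rg@(realises gL gR) rh@(realises hL hR) =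
      realises (moves-⊕ compatibleᴸ L L' rg rh gL hL) (moves-⊕ compatibleᴿ R R' rg rh gR hR)

    moves-⊕ : ∀ {_⇀_ s t g h} → Compatible _⊞_ _⇀_ → ∀ xs ys → Realises s g → Realises t h →
              RealisesMoves Realises _⇀_ s xs → RealisesMoves Realises _⇀_ t ys →
              RealisesMoves Realises _⇀_ (s ⊞ t) (addL xs h ++ addR g ys)
    moves-⊕ {_⇀_} {s} {t} {g} {h} c xs ys rg rh
            (realisesMoves soundˣ completeˣ) (realisesMoves soundʸ completeʸ) =
      realisesMoves (++⁺ (sound-first c xs h soundˣ rh) (sound-second c g ys rg soundʸ)) complete
      where
      complete : ∀ {u} → (s ⊞ t) ⇀ u → Any (Realises u) (addL xs h ++ addR g ys)
      complete m with Compatible.split c m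
      ... | inj₁ (_ , m' , refl) = ++⁺ˡ (complete-first xs h (completeˣ m') rh)
      ... | inj₂ (_ , m' , refl) = ++⁺ʳ (addL xs h) (complete-second g ys rg (completeʸ m'))

    sound-first : ∀ {_⇀_ s t} → Compatible _⊞_ _⇀_ → ∀ xs h →
                  All (λ x → ∃ λ s' → s ⇀ s' × Realises s' x) xs → Realises t h →
                  All (λ y → ∃ λ u → (s ⊞ t) ⇀ u × Realises u y) (addL xs h)
    sound-first c []       h []                 rh = []
    sound-first {t = t} c (x ∷ xs) h ((s' , m , r) ∷ rs) rh =
      (s' ⊞ t , Compatible.inLeft c t m , realises-⊕ x h r rh) ∷ sound-first c xs h rs rh

    sound-second : ∀ {_⇀_ s t} → Compatible _⊞_ _⇀_ → ∀ g ys → Realises s g →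
                   All (λ y → ∃ λ t' → t ⇀ t' × Realises t' y) ys →
                   All (λ z → ∃ λ u → (s ⊞ t) ⇀ u × Realises u z) (addR g ys)
    sound-second c g []       rg []                 = []
    sound-second {s = s} c g (y ∷ ys) rg ((t' , m , r) ∷ rs) =
      (s ⊞ t' , Compatible.inRight c s m , realises-⊕ g y rg r) ∷ sound-second c g ys rg rs

    complete-first : ∀ {s t} xs h → Any (Realises s) xs → Realises t h →
                     Any (Realises (s ⊞ t)) (addL xs h)
    complete-first (x ∷ xs) h (here r)  rh = here (realises-⊕ x h r rh)
    complete-first (x ∷ xs) h (there p) rh = there (complete-first xs h p rh)

    complete-second : ∀ {s t} g ys → Realises s g → Any (Realises t) ys →
                      Any (Realises (s ⊞ t)) (addR g ys)
    complete-second g (y ∷ ys) rg (here r)  = here (realises-⊕ g y rg r)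
    complete-second g (y ∷ ys) rg (there p) = there (complete-second g ys rg p)

  some-option-lost : ∀ {u} {opponentFirst : Game → Bool} {opponentWins : S → Bool} {xs} →
                     Any (Realises u) xs →
                     All (λ x → ∀ {u} → Realises u x → opponentFirst x ≡ opponentWins u) xs →
                     opponentWins u ≡ false → any (not ∘ opponentFirst) xs ≡ true
  some-option-lost {opponentFirst = opp} {xs = _ ∷ xs} (here r) (agree ∷ _) lost =
    cong (λ b → not b ∨ any (not ∘ opp) xs) (trans (agree r) lost)
  some-option-lost {opponentFirst = opp} {xs = x ∷ _} (there p) (_ ∷ agree) lost =
    trans (cong (not (opp x) ∨_) (some-option-lost p agree lost)) (∨-zeroʳ _)

  every-option-won : ∀ {_⇀_ : S → S → Set} {s} {opponentFirst : Game → Bool}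
                       {opponentWins : S → Bool} {xs} →
                     All (λ x → ∃ λ s' → s ⇀ s' × Realises s' x) xs →
                     All (λ x → ∀ {u} → Realises u x → opponentFirst x ≡ opponentWins u) xs →
                     (∀ u → s ⇀ u → opponentWins u ≡ true) → any (not ∘ opponentFirst) xs ≡ false
  every-option-won []                 []             won = refl
  every-option-won {_⇀_} {s} ((u , m , r) ∷ rs) (agree ∷ agrees) won =
    cong₂ (λ a b → not a ∨ b) (trans (agree r) (won u m))
          (every-option-won {_⇀_} {s} rs agrees won)

  mover-wins : ∀ {_⇀_ wins opponentWins s} xs (opponentFirst : Game → Bool) →
               Labelling _⇀_ wins opponentWins → RealisesMoves Realises _⇀_ s xs →
               All (λ x → ∀ {u} → Realises u x → opponentFirst x ≡ opponentWins u) xs →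
               moverWins opponentFirst xs ≡ wins s
  mover-wins {wins = wins} {s = s} [] opp lab (realisesMoves _ complete) _ with wins s in eq
  ... | true  = refl
  ... | false = ⊥-elim (¬Any[] (complete (proj₂ (proj₁ (Labelling.losing lab s eq)))))
  mover-wins {_⇀_} {wins} {s = s} (_ ∷ _) opp lab (realisesMoves sound complete) agree
    with wins s in eq
  ... | false = every-option-won {_⇀_} {s} sound agree (proj₂ (Labelling.losing lab s eq))
  ... | true  with Labelling.winning lab s eq
  ...   | inj₂ (u , m , lost) = some-option-lost (complete m) agree lost
  ...   | inj₁ stuck          = let (u , m , _) = head sound in ⊥-elim (stuck u m)

  module Outcomes (leftWins rightWins : S → Bool)
                  (labellingᴸ : Labelling _⇀ᴸ_ leftWins rightWins)
                  (labellingᴿ : Labelling _⇀ᴿ_ rightWins leftWins) where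
    mutual
      leftFirst-realises : ∀ {s} g → Realises s g → leftFirst g ≡ leftWins s
      leftFirst-realises ⟨ L ∣ R ⟩ (realises movesᴸ _) =
        trans (leftFirst-unfold L R) (mover-wins L rightFirst labellingᴸ movesᴸ (rightFirst-all L))

      rightFirst-realises : ∀ {s} g → Realises s g → rightFirst g ≡ rightWins s
      rightFirst-realises ⟨ L ∣ R ⟩ (realises _ movesᴿ) =
        trans (rightFirst-unfold L R) (mover-wins R leftFirst labellingᴿ movesᴿ (leftFirst-all R))

      leftFirst-all : ∀ xs → All (λ x → ∀ {u} → Realises u x → leftFirst x ≡ leftWins u) xs
      leftFirst-all []       = []
      leftFirst-all (x ∷ xs) = leftFirst-realises x ∷ leftFirst-all xs

      rightFirst-all : ∀ xs → All (λ x → ∀ {u} → Realises u x → rightFirst x ≡ rightWins u) xs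
      rightFirst-all []       = []
      rightFirst-all (x ∷ xs) = rightFirst-realises x ∷ rightFirst-all xs

    outcome-realises : ∀ {s g} → Realises s g → outcome⁻ g ≡ outcomeOf (leftWins s) (rightWins s)
    outcome-realises {s} {g} r = begin
      outcome⁻ g                                 ≡⟨ outcome⁻-spec g ⟩
      outcomeOf (leftFirst g) (rightFirst g)     ≡⟨ cong₂ outcomeOf (leftFirst-realises g r)
                                                                    (rightFirst-realises g r) ⟩
      outcomeOf (leftWins s) (rightWins s)       ∎
      where open ≡-Reasoning

-- Right moves and Right's labelling are those of Left on the conjugate.
record Model : Set₁ where
  field
    State      : Set
    _⊞_        : State → State → State
    swap       : State → State
    swap-⊞     : ∀ s t → swap (s ⊞ t) ≡ swap s ⊞ swap t
    swap-swap  : ∀ s → swap (swap s) ≡ s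
    _⇀_        : State → State → Set
    compatible : Compatible _⊞_ _⇀_
    leftWins   : State → Bool
    labelling  : Labelling _⇀_ leftWins (leftWins ∘ swap)

module ModelTheory (M : Model) where
  open Model M

  _⇀ᴿ_ : State → State → Set
  s ⇀ᴿ u = swap s ⇀ swap u

  rightWins : State → Bool
  rightWins = leftWins ∘ swap

  as-right-move : ∀ {s} u → swap s ⇀ u → s ⇀ᴿ swap u
  as-right-move {s} u m = subst (swap s ⇀_) (sym (swap-swap u)) m

  swap-injective : ∀ {u v} → swap u ≡ swap v → u ≡ v
  swap-injective {u} {v} e = trans (sym (swap-swap u)) (trans (cong swap e) (swap-swap v))

  compatibleᴿ : Compatible _⊞_ _⇀ᴿ_
  compatibleᴿ = record { split = splitᴿ ; inLeft = inLeftᴿ ; inRight = inRightᴿ }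
    where
    open Compatible compatible
    splitᴿ : ∀ {s t u} → (s ⊞ t) ⇀ᴿ u →
             (∃ λ s' → s ⇀ᴿ s' × u ≡ s' ⊞ t) ⊎ (∃ λ t' → t ⇀ᴿ t' × u ≡ s ⊞ t')
    splitᴿ {s} {t} {u} m with split (subst (_⇀ swap u) (swap-⊞ s t) m)
    ... | inj₁ (s' , m' , e) = inj₁ (swap s' , as-right-move s' m' , swap-injective (begin
            swap u                    ≡⟨ e ⟩
            s' ⊞ swap t               ≡⟨ cong (_⊞ swap t) (swap-swap s') ⟨
            swap (swap s') ⊞ swap t   ≡⟨ swap-⊞ (swap s') t ⟨
            swap (swap s' ⊞ t)        ∎))
      where open ≡-Reasoning
    ... | inj₂ (t' , m' , e) = inj₂ (swap t' , as-right-move t' m' , swap-injective (begin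
            swap u                    ≡⟨ e ⟩
            swap s ⊞ t'               ≡⟨ cong (swap s ⊞_) (swap-swap t') ⟨
            swap s ⊞ swap (swap t')   ≡⟨ swap-⊞ s (swap t') ⟨
            swap (s ⊞ swap t')        ∎))
      where open ≡-Reasoning
    inLeftᴿ : ∀ {s s'} t → s ⇀ᴿ s' → (s ⊞ t) ⇀ᴿ (s' ⊞ t)
    inLeftᴿ {s} {s'} t m = subst₂ _⇀_ (sym (swap-⊞ s t)) (sym (swap-⊞ s' t)) (inLeft (swap t) m)
    inRightᴿ : ∀ s {t t'} → t ⇀ᴿ t' → (s ⊞ t) ⇀ᴿ (s ⊞ t')
    inRightᴿ s {t} {t'} m = subst₂ _⇀_ (sym (swap-⊞ s t)) (sym (swap-⊞ s t')) (inRight (swap s) m)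

  labellingᴿ : Labelling _⇀ᴿ_ rightWins leftWins
  labellingᴿ = record { winning = winningᴿ ; losing = losingᴿ }
    where
    open Labelling labelling
    winningᴿ : ∀ s → rightWins s ≡ true →
               (∀ u → ¬ s ⇀ᴿ u) ⊎ (∃ λ u → s ⇀ᴿ u × leftWins u ≡ false)
    winningᴿ s won with winning (swap s) won
    ... | inj₁ stuck          = inj₁ (λ u → stuck (swap u))
    ... | inj₂ (u , m , lost) = inj₂ (swap u , as-right-move u m , lost)
    losingᴿ : ∀ s → rightWins s ≡ false →
              (∃ λ u → s ⇀ᴿ u) × (∀ u → s ⇀ᴿ u → leftWins u ≡ true)
    losingᴿ s lost with losing (swap s) lost
    ... | (u , m) , all-won = (swap u , as-right-move u m)
                            , λ u m → trans (cong leftWins (sym (swap-swap u))) (all-won (swap u) m)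

  open Realisation _⊞_ _⇀_ _⇀ᴿ_ compatible compatibleᴿ public
  open Outcomes leftWins rightWins labelling labellingᴿ public

decided-yes : ∀ {P : Set} (p? : Dec P) → does p? ≡ true → P
decided-yes (yes p) _  = p
decided-yes (no _)  ()

decided-no : ∀ {P : Set} (p? : Dec P) → does p? ≡ false → ¬ P
decided-no (no ¬p) _  = ¬p
decided-no (yes _) ()

-- Sums of copies of 𝟏 and 𝟏bar.
module OnesModel where

  -- Pointwise addition of pairs: the state (a , b) stands for a·𝟏 + b·𝟏bar.
  _+²_ : ℕ × ℕ → ℕ × ℕ → ℕ × ℕ
  (a , b) +² (c , d) = (a + c , b + d)

  -- Left's moves in a·𝟏 + b·𝟏bar: move some 𝟏 to 𝟎.
  data Play𝟏 : ℕ × ℕ → ℕ × ℕ → Set where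
    play-𝟏 : ∀ a b → Play𝟏 (suc a , b) (a , b)

  play𝟏-compatible : Compatible _+²_ Play𝟏
  play𝟏-compatible = record { split = split ; inLeft = inLeft ; inRight = inRight }
    where
    -- splitting is by cases on the summands, so the sum is abstracted as w
    split′ : ∀ s t {w u} → Play𝟏 w u → w ≡ s +² t →
             (∃ λ s' → Play𝟏 s s' × u ≡ s' +² t) ⊎ (∃ λ t' → Play𝟏 t t' × u ≡ s +² t')
    split′ (suc a , b) (c , d)     (play-𝟏 _ _) refl = inj₁ (_ , play-𝟏 a b , refl)
    split′ (zero , b)  (suc c , d) (play-𝟏 _ _) refl = inj₂ (_ , play-𝟏 c d , refl)
    split′ (zero , b)  (zero , d)  (play-𝟏 _ _) ()
    split : ∀ {s t u} → Play𝟏 (s +² t) u →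
            (∃ λ s' → Play𝟏 s s' × u ≡ s' +² t) ⊎ (∃ λ t' → Play𝟏 t t' × u ≡ s +² t')
    split {s} {t} m = split′ s t m refl
    inLeft : ∀ {s s'} t → Play𝟏 s s' → Play𝟏 (s +² t) (s' +² t)
    inLeft (c , d) (play-𝟏 a b) = play-𝟏 (a + c) (b + d)
    inRight : ∀ s {t t'} → Play𝟏 t t' → Play𝟏 (s +² t) (s +² t')
    inRight (a , b) (play-𝟏 c d) rewrite +-suc a c = play-𝟏 (a + c) (b + d)

  -- Conjugation exchanges 𝟏 and 𝟏bar.
  swap² : ℕ × ℕ → ℕ × ℕ
  swap² (a , b) = (b , a)

  leftWins-𝟏 : ℕ × ℕ → Bool
  leftWins-𝟏 (a , b) = does (a ≤? b)

  play𝟏-labelling : Labelling Play𝟏 leftWins-𝟏 (leftWins-𝟏 ∘ swap²)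
  play𝟏-labelling = record { winning = winning ; losing = losing }
    where
    winning : ∀ s → leftWins-𝟏 s ≡ true →
              (∀ u → ¬ Play𝟏 s u) ⊎ (∃ λ u → Play𝟏 s u × leftWins-𝟏 (swap² u) ≡ false)
    winning (zero , b)  _   = inj₁ λ _ ()
    winning (suc a , b) a<b =
      inj₂ (_ , play-𝟏 a b , dec-false (b ≤? a) (<⇒≱ (decided-yes (suc a ≤? b) a<b)))
    losing : ∀ s → leftWins-𝟏 s ≡ false →
             (∃ λ u → Play𝟏 s u) × (∀ u → Play𝟏 s u → leftWins-𝟏 (swap² u) ≡ true)
    losing (zero , b)  ()
    losing (suc a , b) a≮b = (_ , play-𝟏 a b) , λ { _ (play-𝟏 _ _) →
      dec-true (b ≤? a) (s≤s⁻¹ (≰⇒> (decided-no (suc a ≤? b) a≮b))) }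

  ones-model : Model
  ones-model = record
    { State = ℕ × ℕ ; _⊞_ = _+²_ ; swap = swap² ; swap-⊞ = λ _ _ → refl ; swap-swap = λ _ → refl
    ; _⇀_ = Play𝟏 ; compatible = play𝟏-compatible
    ; leftWins = leftWins-𝟏 ; labelling = play𝟏-labelling }

  module Ones = ModelTheory ones-model
  open Ones using (Realises; realises; no-moves; one-move)

  realises-𝟎 : Realises (0 , 0) 𝟎
  realises-𝟎 = realises (no-moves λ ()) (no-moves λ ())

  realises-𝟏 : Realises (1 , 0) 𝟏
  realises-𝟏 = realises (one-move (play-𝟏 0 0) realises-𝟎 λ { (play-𝟏 _ _) → refl }) (no-moves λ ())

  realises-𝟏bar : Realises (0 , 1) 𝟏bar
  realises-𝟏bar = realises (no-moves λ ())
                           (one-move (play-𝟏 0 0) realises-𝟎 λ { (play-𝟏 _ _) → refl })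

  realises-𝟏s : ∀ n m → Realises (n , m) (n · 𝟏 ⊕ m · 𝟏bar)
  realises-𝟏s n m = subst (λ a → Realises (a , m) (n · 𝟏 ⊕ m · 𝟏bar)) (+-identityʳ n)
                          (Ones.realises-⊕ (n · 𝟏) (m · 𝟏bar) (copies-𝟏 n) (copies-𝟏bar m))
    where
    copies-𝟏 : ∀ n → Realises (n , 0) (n · 𝟏)
    copies-𝟏 zero    = realises-𝟎
    copies-𝟏 (suc n) = Ones.realises-⊕ 𝟏 (n · 𝟏) realises-𝟏 (copies-𝟏 n)
    copies-𝟏bar : ∀ m → Realises (0 , m) (m · 𝟏bar)
    copies-𝟏bar zero    = realises-𝟎
    copies-𝟏bar (suc m) = Ones.realises-⊕ 𝟏bar (m · 𝟏bar) realises-𝟏bar (copies-𝟏bar m)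

  outcome-𝟏s : ∀ n m → outcome⁻ (n · 𝟏 ⊕ m · 𝟏bar) ≡ outcomeOf (does (n ≤? m)) (does (m ≤? n))
  outcome-𝟏s n m = Ones.outcome-realises (realises-𝟏s n m)

  𝟏s-separated : ∀ {n m} → n < m → outcome⁻ (n · 𝟏 ⊕ m · 𝟏bar) ≢ outcome⁻ (m · 𝟏 ⊕ m · 𝟏bar)
  𝟏s-separated {n} {m} n<m same = 𝓛≢𝓝 (begin
    𝓛                                              ≡⟨ cong₂ outcomeOf (dec-true (n ≤? m) (<⇒≤ n<m))
                                                                  (dec-false (m ≤? n) (<⇒≱ n<m)) ⟨
    outcomeOf (does (n ≤? m)) (does (m ≤? n))      ≡⟨ outcome-𝟏s n m ⟨
    outcome⁻ (n · 𝟏 ⊕ m · 𝟏bar)                    ≡⟨ same ⟩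
    outcome⁻ (m · 𝟏 ⊕ m · 𝟏bar)                    ≡⟨ outcome-𝟏s m m ⟩
    outcomeOf (does (m ≤? m)) (does (m ≤? m))      ≡⟨ cong (λ b → outcomeOf b b)
                                                            (dec-true (m ≤? m) ≤-refl) ⟩
    𝓝                                              ∎)
    where
    open ≡-Reasoning
    𝓛≢𝓝 : 𝓛 ≢ 𝓝
    𝓛≢𝓝 ()

  infinite-of-𝟏 : ∀ {α β} → Cl α β 𝟏 → Cl α β 𝟏bar → MonoidInfinite (Cl α β)
  infinite-of-𝟏 {α} {β} 𝟏∈ 𝟏bar∈ =
    infinite-by-test 𝟏 𝟏bar (·-closed 𝟎∈ 𝟏∈) (·-closed 𝟎∈ 𝟏bar∈) 𝟏s-separated
    where
    𝟎∈ : Cl α β 𝟎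
    𝟎∈ = cl-L 𝟏∈ (here refl)

open OnesModel using (infinite-of-𝟏)

-- Sums of copies of ρ, ρbar and ⋆.
module RhoModel where

  data Diff : Set where
    0ᵈ     : Diff
    +[1+_] : ℕ → Diff
    -[1+_] : ℕ → Diff

  sucᵈ predᵈ negᵈ : Diff → Diff
  sucᵈ 0ᵈ             = +[1+ 0 ]
  sucᵈ +[1+ n ]       = +[1+ suc n ]
  sucᵈ -[1+ zero ]    = 0ᵈ
  sucᵈ -[1+ suc n ]   = -[1+ n ]
  predᵈ 0ᵈ            = -[1+ 0 ]
  predᵈ -[1+ n ]      = -[1+ suc n ]
  predᵈ +[1+ zero ]   = 0ᵈ
  predᵈ +[1+ suc n ]  = +[1+ n ]
  negᵈ 0ᵈ             = 0ᵈ
  negᵈ +[1+ n ]       = -[1+ n ]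
  negᵈ -[1+ n ]       = +[1+ n ]

  diff : ℕ → ℕ → Diff
  diff zero    zero    = 0ᵈ
  diff (suc p) zero    = +[1+ p ]
  diff zero    (suc q) = -[1+ q ]
  diff (suc p) (suc q) = diff p q

  diff-sucˡ : ∀ p q → diff (suc p) q ≡ sucᵈ (diff p q)
  diff-sucˡ zero    zero          = refl
  diff-sucˡ (suc p) zero          = refl
  diff-sucˡ zero    (suc zero)    = refl
  diff-sucˡ zero    (suc (suc q)) = refl
  diff-sucˡ (suc p) (suc q)       = diff-sucˡ p q

  diff-sucʳ : ∀ p q → diff p (suc q) ≡ predᵈ (diff p q)
  diff-sucʳ zero          zero    = refl
  diff-sucʳ zero          (suc q) = refl
  diff-sucʳ (suc zero)    zero    = refl
  diff-sucʳ (suc (suc p)) zero    = refl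
  diff-sucʳ (suc p)       (suc q) = diff-sucʳ p q

  diff-swap : ∀ p q → diff q p ≡ negᵈ (diff p q)
  diff-swap zero    zero    = refl
  diff-swap zero    (suc q) = refl
  diff-swap (suc p) zero    = refl
  diff-swap (suc p) (suc q) = diff-swap p q

  pred-sucᵈ : ∀ d → predᵈ (sucᵈ d) ≡ d
  pred-sucᵈ 0ᵈ               = refl
  pred-sucᵈ +[1+ n ]         = refl
  pred-sucᵈ -[1+ zero ]      = refl
  pred-sucᵈ -[1+ suc n ]     = refl

  suc-predᵈ : ∀ d → sucᵈ (predᵈ d) ≡ d
  suc-predᵈ 0ᵈ               = refl
  suc-predᵈ -[1+ n ]         = refl
  suc-predᵈ +[1+ zero ]      = refl
  suc-predᵈ +[1+ suc n ]     = refl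

  -- Sign conditions; a positive (negative) difference guarantees a ρ (ρbar) component.
  data Positive : Diff → Set where
    positive : ∀ {n} → Positive +[1+ n ]

  data Negative : Diff → Set where
    negative : ∀ {n} → Negative -[1+ n ]

  diff-zeroˡ : ∀ q → ¬ Positive (diff zero q)
  diff-zeroˡ zero    ()
  diff-zeroˡ (suc q) ()

  diff-zeroʳ : ∀ p → ¬ Negative (diff p zero)
  diff-zeroʳ zero    ()
  diff-zeroʳ (suc p) ()

  parity-suc : ∀ k → parity (suc k) ≡ parity k ⁻¹
  parity-suc k = sym (⁻¹-selfInverse (suc-homo-⁻¹ k))

  -- Left, moving first, wins p·ρ + q·ρbar + k·⋆ iff table (p − q) (parity k) holds.
  table : Diff → Parity → Bool
  table d 0ℙ = even-table d
    where
    even-table : Diff → Bool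
    even-table 0ᵈ                   = true
    even-table +[1+ zero ]          = true
    even-table +[1+ suc _ ]         = false
    even-table -[1+ zero ]          = false
    even-table -[1+ 1 ]             = false
    even-table -[1+ suc (suc _) ]   = true
  table d 1ℙ = odd-table d
    where
    odd-table : Diff → Bool
    odd-table 0ᵈ                         = false
    odd-table +[1+ zero ]                = true
    odd-table +[1+ 1 ]                   = true
    odd-table +[1+ 2 ]                   = true
    odd-table +[1+ suc (suc (suc _)) ]   = false
    odd-table -[1+ _ ]                   = true

  -- The table value for Right (moving first) after each kind of Left move, in terms of
  -- (p − q , parity k) before the move: ρ to ⋆, ρbar to 𝟎, ⋆ to 𝟎.
  afterρ afterρbar after⋆ : Diff → Parity → Bool
  afterρ    d e = table (negᵈ (predᵈ d)) (e ⁻¹)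
  afterρbar d e = table (negᵈ (sucᵈ d)) e
  after⋆    d e = table (negᵈ d) (e ⁻¹)

  -- Where the table says Left wins, some kind of move wins for Left, available by the
  -- side condition (or the position is balanced and even, where ρbar and ⋆ moves win).
  data WinningMove (d : Diff) (e : Parity) : Set where
    balanced : d ≡ 0ᵈ → e ≡ 0ℙ → WinningMove d e
    via-ρ    : Positive d → afterρ d e ≡ false → WinningMove d e
    via-ρbar : Negative d → afterρbar d e ≡ false → WinningMove d e
    via-⋆    : e ≡ 1ℙ → after⋆ d e ≡ false → WinningMove d e

  table-win : ∀ d e → table d e ≡ true → WinningMove d e
  table-win 0ᵈ                      0ℙ _ = balanced refl refl
  table-win +[1+ zero ]             0ℙ _ = via-ρ positive refl
  table-win -[1+ suc (suc _) ]      0ℙ _ = via-ρbar negative refl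
  table-win +[1+ zero ]             1ℙ _ = via-⋆ refl refl
  table-win +[1+ 1 ]                1ℙ _ = via-⋆ refl refl
  table-win +[1+ 2 ]                1ℙ _ = via-ρ positive refl
  table-win -[1+ zero ]             1ℙ _ = via-ρbar negative refl
  table-win -[1+ suc _ ]            1ℙ _ = via-⋆ refl refl

  table-lose : ∀ d e → table d e ≡ false →
               (afterρ d e ≡ true × afterρbar d e ≡ true × after⋆ d e ≡ true) ×
               (e ≡ 1ℙ ⊎ Positive d ⊎ Negative d)
  table-lose +[1+ suc _ ]                0ℙ _ = (refl , refl , refl) , inj₂ (inj₁ positive)
  table-lose -[1+ zero ]                 0ℙ _ = (refl , refl , refl) , inj₂ (inj₂ negative)
  table-lose -[1+ 1 ]                    0ℙ _ = (refl , refl , refl) , inj₂ (inj₂ negative)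
  table-lose 0ᵈ                          1ℙ _ = (refl , refl , refl) , inj₁ refl
  table-lose +[1+ suc (suc (suc _)) ]    1ℙ _ = (refl , refl , refl) , inj₁ refl

  balanced-ρbar : ∀ {d e} → d ≡ 0ᵈ → e ≡ 0ℙ → afterρbar d e ≡ false
  balanced-ρbar refl refl = refl

  balanced-⋆ : ∀ {d e} → d ≡ 0ᵈ → e ≡ 0ℙ → after⋆ d e ≡ false
  balanced-⋆ refl refl = refl

  -- The state (p , q , k) stands for p·ρ + q·ρbar + k·⋆.
  State³ : Set
  State³ = ℕ × ℕ × ℕ

  _+³_ : State³ → State³ → State³
  (p , q , k) +³ (p' , q' , k') = (p + p' , q + q' , k + k')

  -- Conjugation exchanges ρ and ρbar and fixes ⋆.
  swap³ : State³ → State³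
  swap³ (p , q , k) = (q , p , k)

  -- Left's moves: a ρ to ⋆, a ρbar to 𝟎, or a ⋆ to 𝟎.
  data Playρ : State³ → State³ → Set where
    play-ρ    : ∀ p q k → Playρ (suc p , q , k) (p , q , suc k)
    play-ρbar : ∀ p q k → Playρ (p , suc q , k) (p , q , k)
    play-⋆    : ∀ p q k → Playρ (p , q , suc k) (p , q , k)

  playρ-compatible : Compatible _+³_ Playρ
  playρ-compatible =
    record { split = λ {s} {t} m → split′ s t m refl ; inLeft = inLeft ; inRight = inRight }
    where
    -- splitting is by cases on the summands, so the sum is abstracted as w
    split′ : ∀ s t {w u} → Playρ w u → w ≡ s +³ t →
             (∃ λ s' → Playρ s s' × u ≡ s' +³ t) ⊎ (∃ λ t' → Playρ t t' × u ≡ s +³ t')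
    split′ (suc p , q , k) _ (play-ρ _ _ _) refl = inj₁ (_ , play-ρ p q k , refl)
    split′ (zero , q , k) (suc p' , q' , k') (play-ρ _ _ _) refl =
      inj₂ (_ , play-ρ p' q' k' , cong (λ x → (p' , q + q' , x)) (sym (+-suc k k')))
    split′ (zero , _ , _) (zero , _ , _) (play-ρ _ _ _) ()
    split′ (p , suc q , k) _ (play-ρbar _ _ _) refl = inj₁ (_ , play-ρbar p q k , refl)
    split′ (p , zero , k) (p' , suc q' , k') (play-ρbar _ _ _) refl =
      inj₂ (_ , play-ρbar p' q' k' , refl)
    split′ (_ , zero , _) (_ , zero , _) (play-ρbar _ _ _) ()
    split′ (p , q , suc k) _ (play-⋆ _ _ _) refl = inj₁ (_ , play-⋆ p q k , refl)
    split′ (p , q , zero) (p' , q' , suc k') (play-⋆ _ _ _) refl =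
      inj₂ (_ , play-⋆ p' q' k' , refl)
    split′ (_ , _ , zero) (_ , _ , zero) (play-⋆ _ _ _) ()
    inLeft : ∀ {s s'} t → Playρ s s' → Playρ (s +³ t) (s' +³ t)
    inLeft (p' , q' , k') (play-ρ p q k)    = play-ρ (p + p') (q + q') (k + k')
    inLeft (p' , q' , k') (play-ρbar p q k) = play-ρbar (p + p') (q + q') (k + k')
    inLeft (p' , q' , k') (play-⋆ p q k)    = play-⋆ (p + p') (q + q') (k + k')
    inRight : ∀ s {t t'} → Playρ t t' → Playρ (s +³ t) (s +³ t')
    inRight (p , q , k) (play-ρ p' q' k')    rewrite +-suc p p' | +-suc k k' =
      play-ρ (p + p') (q + q') (k + k')
    inRight (p , q , k) (play-ρbar p' q' k') rewrite +-suc q q' =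
      play-ρbar (p + p') (q + q') (k + k')
    inRight (p , q , k) (play-⋆ p' q' k')    rewrite +-suc k k' = play-⋆ (p + p') (q + q') (k + k')

  leftWins-ρ : State³ → Bool
  leftWins-ρ (p , q , k) = table (diff p q) (parity k)

  after-play-ρ : ∀ p q k → leftWins-ρ (swap³ (p , q , suc k)) ≡ afterρ (diff (suc p) q) (parity k)
  after-play-ρ p q k = cong₂ table (begin
    diff q p                              ≡⟨ diff-swap p q ⟩
    negᵈ (diff p q)                       ≡⟨ cong negᵈ (pred-sucᵈ (diff p q)) ⟨
    negᵈ (predᵈ (sucᵈ (diff p q)))        ≡⟨ cong (negᵈ ∘ predᵈ) (diff-sucˡ p q) ⟨
    negᵈ (predᵈ (diff (suc p) q))         ∎) (parity-suc k)
    where open ≡-Reasoning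

  after-play-ρbar : ∀ p q k → leftWins-ρ (swap³ (p , q , k)) ≡ afterρbar (diff p (suc q)) (parity k)
  after-play-ρbar p q k = cong (λ d → table d (parity k)) (begin
    diff q p                              ≡⟨ diff-swap p q ⟩
    negᵈ (diff p q)                       ≡⟨ cong negᵈ (suc-predᵈ (diff p q)) ⟨
    negᵈ (sucᵈ (predᵈ (diff p q)))        ≡⟨ cong (negᵈ ∘ sucᵈ) (diff-sucʳ p q) ⟨
    negᵈ (sucᵈ (diff p (suc q)))          ∎)
    where open ≡-Reasoning

  after-play-⋆ : ∀ p q k → leftWins-ρ (swap³ (p , q , k)) ≡ after⋆ (diff p q) (parity (suc k))
  after-play-⋆ p q k = cong₂ table (diff-swap p q) (sym (suc-homo-⁻¹ k))

  playρ-labelling : Labelling Playρ leftWins-ρ (leftWins-ρ ∘ swap³)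
  playρ-labelling = record
    { winning = λ { (p , q , k) won → winning-move p q k (table-win (diff p q) (parity k) won) }
    ; losing  = λ { (p , q , k) lost →
                    losing-moves p q k (table-lose (diff p q) (parity k) lost) } }
    where
    winning-move : ∀ p q k → WinningMove (diff p q) (parity k) →
                   (∀ u → ¬ Playρ (p , q , k) u) ⊎
                   (∃ λ u → Playρ (p , q , k) u × leftWins-ρ (swap³ u) ≡ false)
    winning-move p (suc q) k (balanced d≡0 e≡0) =
      inj₂ (_ , play-ρbar p q k , trans (after-play-ρbar p q k) (balanced-ρbar d≡0 e≡0))
    winning-move p zero (suc k) (balanced d≡0 e≡0) =
      inj₂ (_ , play-⋆ p zero k , trans (after-play-⋆ p zero k) (balanced-⋆ d≡0 e≡0))
    winning-move zero zero zero (balanced _ _) = inj₁ λ _ ()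
    winning-move (suc p) zero zero (balanced () _)
    winning-move zero q k (via-ρ pos _) = ⊥-elim (diff-zeroˡ q pos)
    winning-move (suc p) q k (via-ρ _ lost) =
      inj₂ (_ , play-ρ p q k , trans (after-play-ρ p q k) lost)
    winning-move p zero k (via-ρbar neg _) = ⊥-elim (diff-zeroʳ p neg)
    winning-move p (suc q) k (via-ρbar _ lost) =
      inj₂ (_ , play-ρbar p q k , trans (after-play-ρbar p q k) lost)
    winning-move p q zero (via-⋆ () _)
    winning-move p q (suc k) (via-⋆ _ lost) =
      inj₂ (_ , play-⋆ p q k , trans (after-play-⋆ p q k) lost)

    some-move : ∀ p q k → parity k ≡ 1ℙ ⊎ Positive (diff p q) ⊎ Negative (diff p q) →
                ∃ λ u → Playρ (p , q , k) u
    some-move p q zero    (inj₁ ())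
    some-move p q (suc k) (inj₁ _)          = _ , play-⋆ p q k
    some-move zero q k    (inj₂ (inj₁ pos)) = ⊥-elim (diff-zeroˡ q pos)
    some-move (suc p) q k (inj₂ (inj₁ _))   = _ , play-ρ p q k
    some-move p zero k    (inj₂ (inj₂ neg)) = ⊥-elim (diff-zeroʳ p neg)
    some-move p (suc q) k (inj₂ (inj₂ _))   = _ , play-ρbar p q k

    losing-moves : ∀ p q k →
                   (afterρ (diff p q) (parity k) ≡ true × afterρbar (diff p q) (parity k) ≡ true ×
                    after⋆ (diff p q) (parity k) ≡ true) ×
                   (parity k ≡ 1ℙ ⊎ Positive (diff p q) ⊎ Negative (diff p q)) →
                   (∃ λ u → Playρ (p , q , k) u) ×
                   (∀ u → Playρ (p , q , k) u → leftWins-ρ (swap³ u) ≡ true)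
    losing-moves p q k ((wonρ , wonρbar , won⋆) , available) = some-move p q k available , λ
      { _ (play-ρ p' _ _)    → trans (after-play-ρ p' q k) wonρ
      ; _ (play-ρbar _ q' _) → trans (after-play-ρbar p q' k) wonρbar
      ; _ (play-⋆ _ _ k')    → trans (after-play-⋆ p q k') won⋆ }

  ρ-model : Model
  ρ-model = record
    { State = State³ ; _⊞_ = _+³_ ; swap = swap³ ; swap-⊞ = λ _ _ → refl ; swap-swap = λ _ → refl
    ; _⇀_ = Playρ ; compatible = playρ-compatible
    ; leftWins = leftWins-ρ ; labelling = playρ-labelling }

  module Rhos = ModelTheory ρ-model
  open Rhos using (Realises; realises; no-moves; one-move)

  realises-𝟎 : Realises (0 , 0 , 0) 𝟎
  realises-𝟎 = realises (no-moves λ ()) (no-moves λ ())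

  realises-⋆ : Realises (0 , 0 , 1) ⋆
  realises-⋆ = realises (one-move (play-⋆ 0 0 0) realises-𝟎 λ { (play-⋆ _ _ _) → refl })
                        (one-move (play-⋆ 0 0 0) realises-𝟎 λ { (play-⋆ _ _ _) → refl })

  realises-ρ : Realises (1 , 0 , 0) ρ
  realises-ρ = realises (one-move (play-ρ 0 0 0) realises-⋆ λ { (play-ρ _ _ _) → refl })
                        (one-move (play-ρbar 0 0 0) realises-𝟎 λ { (play-ρbar _ _ _) → refl })

  realises-ρbar : Realises (0 , 1 , 0) ρbar
  realises-ρbar = realises (one-move (play-ρbar 0 0 0) realises-𝟎 λ { (play-ρbar _ _ _) → refl })
                           (one-move (play-ρ 0 0 0) realises-⋆ λ { (play-ρ _ _ _) → refl })

  realises-ρs : ∀ n m → Realises (n , m , 0) (n · ρ ⊕ m · ρbar)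
  realises-ρs n m = subst (λ a → Realises (a , m , 0) (n · ρ ⊕ m · ρbar)) (+-identityʳ n)
                          (Rhos.realises-⊕ (n · ρ) (m · ρbar) (copies-ρ n) (copies-ρbar m))
    where
    copies-ρ : ∀ n → Realises (n , 0 , 0) (n · ρ)
    copies-ρ zero    = realises-𝟎
    copies-ρ (suc n) = Rhos.realises-⊕ ρ (n · ρ) realises-ρ (copies-ρ n)
    copies-ρbar : ∀ m → Realises (0 , m , 0) (m · ρbar)
    copies-ρbar zero    = realises-𝟎
    copies-ρbar (suc m) = Rhos.realises-⊕ ρbar (m · ρbar) realises-ρbar (copies-ρbar m)

  diff-self : ∀ m → diff m m ≡ 0ᵈ
  diff-self zero    = refl
  diff-self (suc m) = diff-self m

  diff-< : ∀ {n m} → n < m → ∃ λ j → diff n m ≡ -[1+ j ] × diff m n ≡ +[1+ j ]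
  diff-< {zero}  {suc m} _       = m , refl , refl
  diff-< {suc n} {suc m} (s≤s n<m) = diff-< n<m

  starlessOutcome : Diff → Diff → Outcome
  starlessOutcome d d' = outcomeOf (table d 0ℙ) (table d' 0ℙ)

  outcome-ρs : ∀ n m → outcome⁻ (n · ρ ⊕ m · ρbar) ≡ starlessOutcome (diff n m) (diff m n)
  outcome-ρs n m = Rhos.outcome-realises (realises-ρs n m)

  unbalanced-not-𝓝 : ∀ j → starlessOutcome -[1+ j ] +[1+ j ] ≢ 𝓝
  unbalanced-not-𝓝 zero          ()
  unbalanced-not-𝓝 (suc zero)    ()
  unbalanced-not-𝓝 (suc (suc j)) ()

  ρs-separated : ∀ {n m} → n < m → outcome⁻ (n · ρ ⊕ m · ρbar) ≢ outcome⁻ (m · ρ ⊕ m · ρbar)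
  ρs-separated {n} {m} n<m same with diff-< n<m
  ... | j , n−m , m−n = unbalanced-not-𝓝 j (begin
    starlessOutcome -[1+ j ] +[1+ j ]            ≡⟨ cong₂ starlessOutcome n−m m−n ⟨
    starlessOutcome (diff n m) (diff m n)        ≡⟨ outcome-ρs n m ⟨
    outcome⁻ (n · ρ ⊕ m · ρbar)                  ≡⟨ same ⟩
    outcome⁻ (m · ρ ⊕ m · ρbar)                  ≡⟨ outcome-ρs m m ⟩
    starlessOutcome (diff m m) (diff m m)        ≡⟨ cong₂ starlessOutcome (diff-self m) (diff-self m) ⟩
    𝓝                                            ∎)
    where open ≡-Reasoning

  infinite-of-ρ : ∀ {α β} → Cl α β ρ → Cl α β ρbar → MonoidInfinite (Cl α β)
  infinite-of-ρ {α} {β} ρ∈ ρbar∈ =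
    infinite-by-test ρ ρbar (·-closed 𝟎∈ ρ∈) (·-closed 𝟎∈ ρbar∈) ρs-separated
    where
    𝟎∈ : Cl α β 𝟎
    𝟎∈ = cl-R ρ∈ (here refl)

open RhoModel using (infinite-of-ρ)

data Nonempty : List Game → Set where
  nonempty : ∀ {x xs} → Nonempty (x ∷ xs)

-- A parity game of parity b: all options have the opposite parity, and odd games offer
-- both players a move. Their outcome depends on the parity alone (see parity-outcome).
data ParityGame : Parity → Game → Set where
  parity-game : ∀ {b L R} → All (ParityGame (b ⁻¹)) L → All (ParityGame (b ⁻¹)) R →
                (b ≡ 1ℙ → Nonempty L × Nonempty R) → ParityGame b ⟨ L ∣ R ⟩

⁻¹-+ˡ : ∀ b c → b ⁻¹ ℙ.+ c ≡ (b ℙ.+ c) ⁻¹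
⁻¹-+ˡ 0ℙ c = refl
⁻¹-+ˡ 1ℙ c = sym (⁻¹-involutive c)

⁻¹-+ʳ : ∀ b c → b ℙ.+ c ⁻¹ ≡ (b ℙ.+ c) ⁻¹
⁻¹-+ʳ 0ℙ c = refl
⁻¹-+ʳ 1ℙ c = refl

mutual
  parity-⊕ : ∀ {b c} g h → ParityGame b g → ParityGame c h → ParityGame (b ℙ.+ c) (g ⊕ h)
  parity-⊕ {b} {c} ⟨ L ∣ R ⟩ ⟨ L' ∣ R' ⟩
           pg@(parity-game gL gR movable) ph@(parity-game hL hR movable') =
    parity-game (++⁺ (parity-addL L ⟨ L' ∣ R' ⟩ gL ph) (parity-addR ⟨ L ∣ R ⟩ L' pg hL))
                (++⁺ (parity-addL R ⟨ L' ∣ R' ⟩ gR ph) (parity-addR ⟨ L ∣ R ⟩ R' pg hR))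
                (sum-movable b c movable movable')
    where
    -- an odd sum has an odd summand, whose moves give moves of the sum
    sum-movable : ∀ b c → (b ≡ 1ℙ → Nonempty L × Nonempty R) →
                  (c ≡ 1ℙ → Nonempty L' × Nonempty R') → b ℙ.+ c ≡ 1ℙ →
                  Nonempty (addL L ⟨ L' ∣ R' ⟩ ++ addR ⟨ L ∣ R ⟩ L') ×
                  Nonempty (addL R ⟨ L' ∣ R' ⟩ ++ addR ⟨ L ∣ R ⟩ R')
    sum-movable 1ℙ c m _ _ with m refl
    ... | nonempty , nonempty = nonempty , nonempty
    sum-movable 0ℙ c _ m' odd with m' odd
    ... | nonempty , nonempty = after (addL L _) , after (addL R _)
      where
      after : ∀ xs {y ys} → Nonempty (xs ++ y ∷ ys)
      after []       = nonempty
      after (_ ∷ _)  = nonempty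

  parity-addL : ∀ {b c} xs h → All (ParityGame (b ⁻¹)) xs → ParityGame c h →
                All (ParityGame ((b ℙ.+ c) ⁻¹)) (addL xs h)
  parity-addL []       h []         ph = []
  parity-addL {b} {c} (x ∷ xs) h (px ∷ pxs) ph =
    subst (λ a → ParityGame a (x ⊕ h)) (⁻¹-+ˡ b c) (parity-⊕ x h px ph) ∷ parity-addL xs h pxs ph

  parity-addR : ∀ {b c} g ys → ParityGame b g → All (ParityGame (c ⁻¹)) ys →
                All (ParityGame ((b ℙ.+ c) ⁻¹)) (addR g ys)
  parity-addR g []       pg []         = []
  parity-addR {b} {c} g (y ∷ ys) pg (py ∷ pys) =
    subst (λ a → ParityGame a (g ⊕ y)) (⁻¹-+ʳ b c) (parity-⊕ g y pg py) ∷ parity-addR g ys pg pys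

firstWins : Parity → Bool
firstWins 0ℙ = true
firstWins 1ℙ = false

parity-mover : ∀ b {xs} (opponentFirst : Game → Bool) →
               All (λ x → opponentFirst x ≡ firstWins (b ⁻¹)) xs → (b ≡ 1ℙ → Nonempty xs) →
               moverWins opponentFirst xs ≡ firstWins b
parity-mover 0ℙ {[]}     opp _            _ = refl
parity-mover 0ℙ {x ∷ xs} opp (lost ∷ _)   _ = cong (λ v → not v ∨ any (not ∘ opp) xs) lost
parity-mover 1ℙ {xs}     opp won          movable with movable refl
... | nonempty = all-won won
  where
  all-won : ∀ {ys} → All (λ y → opp y ≡ true) ys → any (not ∘ opp) ys ≡ false
  all-won []           = refl
  all-won (w ∷ ws)     = cong₂ (λ v r → not v ∨ r) w (all-won ws)

mutual
  parity-leftFirst : ∀ {b} g → ParityGame b g → leftFirst g ≡ firstWins b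
  parity-leftFirst {b} ⟨ L ∣ R ⟩ (parity-game pL _ movable) =
    trans (leftFirst-unfold L R)
          (parity-mover b rightFirst (parity-rightFirst-all pL) (proj₁ ∘ movable))

  parity-rightFirst : ∀ {b} g → ParityGame b g → rightFirst g ≡ firstWins b
  parity-rightFirst {b} ⟨ L ∣ R ⟩ (parity-game _ pR movable) =
    trans (rightFirst-unfold L R)
          (parity-mover b leftFirst (parity-leftFirst-all pR) (proj₂ ∘ movable))

  parity-leftFirst-all : ∀ {c xs} → All (ParityGame c) xs → All (λ x → leftFirst x ≡ firstWins c) xs
  parity-leftFirst-all []         = []
  parity-leftFirst-all (p ∷ ps)   = parity-leftFirst _ p ∷ parity-leftFirst-all ps

  parity-rightFirst-all : ∀ {c xs} → All (ParityGame c) xs →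
                          All (λ x → rightFirst x ≡ firstWins c) xs
  parity-rightFirst-all []        = []
  parity-rightFirst-all (p ∷ ps)  = parity-rightFirst _ p ∷ parity-rightFirst-all ps

parity-outcome : ∀ {b g} → ParityGame b g → outcome⁻ g ≡ outcomeOf (firstWins b) (firstWins b)
parity-outcome {b} {g} p =
  trans (outcome⁻-spec g) (cong₂ outcomeOf (parity-leftFirst g p) (parity-rightFirst g p))

mutual
  parity-conj : ∀ {b} g → ParityGame b g → ParityGame b (conj g)
  parity-conj ⟨ L ∣ R ⟩ (parity-game pL pR movable) =
    parity-game (parity-conjs R pR) (parity-conjs L pL) (λ odd → swap-movable (movable odd))
    where
    nonempty-conjs : ∀ {xs} → Nonempty xs → Nonempty (conjs xs)
    nonempty-conjs nonempty = nonempty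
    swap-movable : Nonempty L × Nonempty R → Nonempty (conjs R) × Nonempty (conjs L)
    swap-movable (nL , nR) = nonempty-conjs nR , nonempty-conjs nL

  parity-conjs : ∀ {c} xs → All (ParityGame c) xs → All (ParityGame c) (conjs xs)
  parity-conjs []       []       = []
  parity-conjs (x ∷ xs) (p ∷ ps) = parity-conj x p ∷ parity-conjs xs ps

AllParity : (Game → Set) → Set
AllParity Γ = ∀ g → Γ g → ∃ λ b → ParityGame b g

closure-parity : ∀ {α β a b} → ParityGame a α → ParityGame b β → AllParity (Cl α β)
closure-parity pα pβ _ cl-α = _ , pα
closure-parity pα pβ _ cl-β = _ , pβ
closure-parity pα pβ _ (cl-sum {g} {h} g∈ h∈) =
  _ , parity-⊕ g h (proj₂ (closure-parity pα pβ g g∈)) (proj₂ (closure-parity pα pβ h h∈))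
closure-parity pα pβ x (cl-L {g} g∈ x∈) with closure-parity pα pβ g g∈
... | _ , parity-game pL _ _ = _ , All.lookup pL x∈
closure-parity pα pβ x (cl-R {g} g∈ x∈) with closure-parity pα pβ g g∈
... | _ , parity-game _ pR _ = _ , All.lookup pR x∈

same-parity-equivalent : ∀ {Γ : Game → Set} {b g x} → AllParity Γ →
                         ParityGame b g → ParityGame b x → g ≡[ Γ ] x
same-parity-equivalent {g = g} {x} allParity pg px γ γ∈ with allParity γ γ∈
... | _ , pγ =
  trans (parity-outcome (parity-⊕ g γ pg pγ)) (sym (parity-outcome (parity-⊕ x γ px pγ)))

parity-finite : ∀ {Γ : Game → Set} {e o} → AllParity Γ →
                Γ e → ParityGame 0ℙ e → Γ o → ParityGame 1ℙ o → MonoidFinite Γ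
parity-finite {Γ} {e} {o} allParity e∈ pe o∈ po = (e ∷ o ∷ []) , (e∈ ∷ o∈ ∷ []) , cover
  where
  cover : ∀ g → Γ g → Any (λ x → g ≡[ Γ ] x) (e ∷ o ∷ [])
  cover g g∈ with allParity g g∈
  ... | 0ℙ , pg = here (same-parity-equivalent allParity pg pe)
  ... | 1ℙ , pg = there (here (same-parity-equivalent allParity pg po))

mutual
  parity-≅ : ∀ {b g h} → ParityGame b g → h ≅ g → ParityGame b h
  parity-≅ (parity-game pL pR movable) (≅-intro hL⊆gL gL⊆hL hR⊆gR gR⊆hR) =
    parity-game (parity-⊆ hL⊆gL pL) (parity-⊆ hR⊆gR pR)
                (λ odd → let (nL , nR) = movable odd
                         in nonempty-⊆ gL⊆hL nL , nonempty-⊆ gR⊆hR nR)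

  parity-⊆ : ∀ {c xs ys} → All (λ x → Any (x ≅_) ys) xs → All (ParityGame c) ys →
             All (ParityGame c) xs
  parity-⊆ []         pys = []
  parity-⊆ (x∈ ∷ x∈s) pys = parity-∈ x∈ pys ∷ parity-⊆ x∈s pys

  parity-∈ : ∀ {c x ys} → Any (x ≅_) ys → All (ParityGame c) ys → ParityGame c x
  parity-∈ (here x≅y) (py ∷ _)   = parity-≅ py x≅y
  parity-∈ (there x∈) (_ ∷ pys)  = parity-∈ x∈ pys

  nonempty-⊆ : ∀ {xs ys} → All (λ y → Any (y ≅_) xs) ys → Nonempty ys → Nonempty xs
  nonempty-⊆ (here _ ∷ _)  nonempty = nonempty
  nonempty-⊆ (there _ ∷ _) nonempty = nonempty

-- 𝟎 is not odd; hence 𝟏, 𝟏bar, ρ, ρbar are not parity games.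
¬odd-𝟎 : ¬ ParityGame 1ℙ 𝟎
¬odd-𝟎 (parity-game _ _ movable) with movable refl
... | () , _

¬parity-𝟏 : ∀ {b} → ¬ ParityGame b 𝟏
¬parity-𝟏 {0ℙ} (parity-game (p𝟎 ∷ []) _ _) = ¬odd-𝟎 p𝟎
¬parity-𝟏 {1ℙ} (parity-game _ _ movable) with movable refl
... | _ , ()

¬parity-𝟏bar : ∀ {b} → ¬ ParityGame b 𝟏bar
¬parity-𝟏bar {0ℙ} (parity-game _ (p𝟎 ∷ []) _) = ¬odd-𝟎 p𝟎
¬parity-𝟏bar {1ℙ} (parity-game _ _ movable) with movable refl
... | () , _

¬parity-ρ : ∀ {b} → ¬ ParityGame b ρ
¬parity-ρ {0ℙ} (parity-game _ (p𝟎 ∷ []) _)                           = ¬odd-𝟎 p𝟎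
¬parity-ρ {1ℙ} (parity-game (parity-game (p𝟎 ∷ []) _ _ ∷ []) _ _)   = ¬odd-𝟎 p𝟎

¬parity-ρbar : ∀ {b} → ¬ ParityGame b ρbar
¬parity-ρbar {0ℙ} (parity-game (p𝟎 ∷ []) _ _)                        = ¬odd-𝟎 p𝟎
¬parity-ρbar {1ℙ} (parity-game _ (parity-game (p𝟎 ∷ []) _ _ ∷ []) _) = ¬odd-𝟎 p𝟎

ContainsOneOrRho : (Game → Set) → Set
ContainsOneOrRho Γ = (𝟏 ∈Γ Γ) ⊎ (𝟏bar ∈Γ Γ) ⊎ (ρ ∈Γ Γ) ⊎ (ρbar ∈Γ Γ)

not-in-parity-set : ∀ {Γ x} → AllParity Γ → (∀ {b} → ¬ ParityGame b x) → ¬ (x ∈Γ Γ)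
not-in-parity-set allParity ¬px (g , g∈ , g≅x) =
  ¬px (parity-≅ (proj₂ (allParity g g∈)) (≅-sym g≅x))

parity-excludes : ∀ {Γ} → AllParity Γ → ¬ ContainsOneOrRho Γ
parity-excludes all (inj₁ 𝟏∈)                  = not-in-parity-set all ¬parity-𝟏 𝟏∈
parity-excludes all (inj₂ (inj₁ 𝟏bar∈))        = not-in-parity-set all ¬parity-𝟏bar 𝟏bar∈
parity-excludes all (inj₂ (inj₂ (inj₁ ρ∈)))    = not-in-parity-set all ¬parity-ρ ρ∈
parity-excludes all (inj₂ (inj₂ (inj₂ ρbar∈))) = not-in-parity-set all ¬parity-ρbar ρbar∈

Classified : Game → Set
Classified χ = MonoidInfinite (Cl χ (conj χ)) ⇔ ContainsOneOrRho (Cl χ (conj χ))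

via-𝟏 : ∀ {χ} → Cl χ (conj χ) 𝟏 → Cl χ (conj χ) 𝟏bar → Classified χ
via-𝟏 𝟏∈ 𝟏bar∈ = mk⇔ (λ _ → inj₁ (𝟏 , 𝟏∈ , ≅-refl 𝟏)) (λ _ → infinite-of-𝟏 𝟏∈ 𝟏bar∈)

via-ρ : ∀ {χ} → Cl χ (conj χ) ρ → Cl χ (conj χ) ρbar → Classified χ
via-ρ ρ∈ ρbar∈ = mk⇔ (λ _ → inj₂ (inj₂ (inj₁ (ρ , ρ∈ , ≅-refl ρ)))) (λ _ → infinite-of-ρ ρ∈ ρbar∈)

via-finite : ∀ {χ} → MonoidFinite (Cl χ (conj χ)) → ¬ ContainsOneOrRho (Cl χ (conj χ)) →
             Classified χ
via-finite finite excluded =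
  mk⇔ (λ infinite → ⊥-elim (infinite finite)) (λ contains → ⊥-elim (excluded contains))

via-parity : ∀ {χ b e o} → ParityGame b χ → Cl χ (conj χ) e → ParityGame 0ℙ e →
             Cl χ (conj χ) o → ParityGame 1ℙ o → Classified χ
via-parity {χ} pχ e∈ pe o∈ po =
  via-finite (parity-finite allParity e∈ pe o∈ po) (parity-excludes allParity)
  where
  allParity : AllParity (Cl χ (conj χ))
  allParity = closure-parity pχ (parity-conj χ pχ)

only-𝟎-in-cl : ∀ {g} → Cl 𝟎 𝟎 g → g ≡ 𝟎
only-𝟎-in-cl cl-α               = refl
only-𝟎-in-cl cl-β               = refl
only-𝟎-in-cl (cl-sum g∈ h∈) rewrite only-𝟎-in-cl g∈ | only-𝟎-in-cl h∈ = refl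
only-𝟎-in-cl (cl-L g∈ x∈) with only-𝟎-in-cl g∈
only-𝟎-in-cl (cl-L g∈ ()) | refl
only-𝟎-in-cl (cl-R g∈ x∈) with only-𝟎-in-cl g∈
only-𝟎-in-cl (cl-R g∈ ()) | refl

parity-𝟎 : ParityGame 0ℙ 𝟎
parity-𝟎 = parity-game [] [] λ ()

parity-⋆ : ParityGame 1ℙ ⋆
parity-⋆ = parity-game (parity-𝟎 ∷ []) (parity-𝟎 ∷ []) λ _ → nonempty , nonempty

even-game : ∀ {L R} → All (ParityGame 1ℙ) L → All (ParityGame 1ℙ) R → ParityGame 0ℙ ⟨ L ∣ R ⟩
even-game pL pR = parity-game pL pR λ ()

via-even : ∀ {χ} → ParityGame 0ℙ χ → Cl χ (conj χ) ⋆ → Classified χ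
via-even pχ ⋆∈ = via-parity pχ cl-α pχ ⋆∈ parity-⋆

via-𝟎 : Classified 𝟎
via-𝟎 = via-finite ((𝟎 ∷ []) , (cl-α ∷ []) , λ g g∈ → here λ γ _ → cong (λ x → outcome⁻ (x ⊕ γ))
                                                                            (only-𝟎-in-cl g∈))
                   (parity-excludes (closure-parity parity-𝟎 parity-𝟎))

classify : ∀ {L R} → AtMostOne Simple L → AtMostOne Simple R → Classified ⟨ L ∣ R ⟩
classify (one s𝟏)    _           = via-𝟏 (cl-L cl-α (here refl)) (cl-R cl-β (here refl))
classify (one s𝟏bar) _           = via-𝟏 (cl-R cl-β (here refl)) (cl-L cl-α (here refl))
classify _           (one s𝟏)    = via-𝟏 (cl-R cl-α (here refl)) (cl-L cl-β (here refl))
classify _           (one s𝟏bar) = via-𝟏 (cl-L cl-β (here refl)) (cl-R cl-α (here refl))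
classify none        none        = via-𝟎
classify (one s𝟎)    none        = via-𝟏 cl-α cl-β
classify none        (one s𝟎)    = via-𝟏 cl-β cl-α
classify (one s⋆)    (one s𝟎)    = via-ρ cl-α cl-β
classify (one s𝟎)    (one s⋆)    = via-ρ cl-β cl-α
classify (one s𝟎)    (one s𝟎)    =
  via-parity parity-⋆ (cl-L cl-α (here refl)) parity-𝟎 cl-α parity-⋆
classify (one s⋆)    none        = via-even (even-game (parity-⋆ ∷ []) []) (cl-L cl-α (here refl))
classify none        (one s⋆)    = via-even (even-game [] (parity-⋆ ∷ [])) (cl-R cl-α (here refl))
classify (one s⋆)    (one s⋆)    =
  via-even (even-game (parity-⋆ ∷ []) (parity-⋆ ∷ [])) (cl-L cl-α (here refl))

theorem3p2p3 : (χ : Game) → Binary χ → birthday χ ≤ 2 →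
    (MonoidInfinite (Cl χ (conj χ)) ⇔
    ((𝟏 ∈Γ Cl χ (conj χ)) ⊎ (𝟏bar ∈Γ Cl χ (conj χ)) ⊎ (ρ ∈Γ Cl χ (conj χ)) ⊎ (ρbar ∈Γ Cl χ (conj χ))))
theorem3p2p3 ⟨ L ∣ R ⟩ binary-χ young with binary-options binary-χ young
... | optionsL , optionsR = classify (simple-options optionsL) (simple-options optionsR)
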